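{- Let $R$ be a commutative ring, $A,B$ finite $R$-modules, $C$ a cyclic group of odd order $r$, and $\lambda:A\times B\to C$ a $\mathbb{Z}$-bilinear, $R$-balanced, non-degenerate pairing, with $A\neq 0$. Let $\mathcal{H}=\mathcal{H}(A,B,C,\lambda)$. For $\phi\in\mathrm{Aut}^0_R(\mathcal{H})$ define $\eta_\phi:A\oplus B\to C$ by $\phi(\mathcal{D}(\mathbf{a}))=\mathcal{D}(\bar\phi(\mathbf{a}))\,m(\eta_\phi(\mathbf{a}))$ for all $\mathbf{a}\in A\oplus B$. Then each $\eta_\phi$ lies in $\mathrm{Hom}(A\oplus B,C)$, each $\bar\phi$ lies in $\mathrm{Sp}_R(A\oplus B;\delta)$, and the map $\Theta_{\mathcal{D}}:\mathrm{Aut}^0_R(\mathcal{H})\to \mathrm{Hom}(A\oplus B,C)\rtimes \mathrm{Sp}_R(A\oplus B;\delta)$, $\phi\mapsto(\eta_\phi,\bar\phi^{ -1})$, is a group anti-isomorphism.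
   Context: $\mathcal{H}(A,B,C,\lambda)$ is the set $A\times B\times C$ with elements written $h(a,b,c)$ and multiplication $h(a,b,c)h(a',b',c')=h(a+a',b+b',c+c'+\lambda(a,b'))$. $R$-balanced means $\lambda(ra,b)=\lambda(a,rb)$; non-degenerate means the left and right kernels of $\lambda$ are zero. Let $m:C\to\mathcal{H}$, $c\mapsto h(0,0,c)$; under these hypotheses $m(C)$ is the centre $Z$ of $\mathcal{H}$ and $\mathcal{H}/Z$ is identified with $A\oplus B$ via $h(a,b,c)\mapsto (a,b)$. For $\phi\in\mathrm{Aut}(\mathcal{H})$, $\bar\phi$ is the induced automorphism of $\mathcal{H}/Z=A\oplus B$. $\mathrm{Aut}^0_R(\mathcal{H})$ is the group of automorphisms of $\mathcal{H}$ fixing $Z$ elementwise and with $\bar\phi$ $R$-linear. Define $\delta:(A\oplus B)^2\to C$ by $\delta((a,b),(a',b'))=\lambda(a,b')-\lambda(a',b)$, and $\mathrm{Sp}_R(A\oplus B;\delta)$ = the set of $R$-linear automorphisms $\alpha$ of $A\oplus B$ with $\delta(\alpha\mathbf{a},\alpha\mathbf{a}')=\delta(\mathbf{a},\mathbf{a}')$ for all $\mathbf{a},\mathbf{a}'$. Since $r$ is odd, each $c\in C$ has a unique half $\tfrac12 c$; define $\mathcal{D}:A\oplus B\to\mathcal{H}$ by $\mathcal{D}((a,b))=h(a,b,\tfrac12\lambda(a,b))$. The semidirect product $\mathrm{Hom}(A\oplus B,C)\rtimes\mathrm{Sp}_R(A\oplus B;\delta)$ has underlying set the product and multiplication $(\eta_1,\alpha_1)\cdot(\eta_2,\alpha_2)=(\eta_1+\eta_2\circ\alpha_1^{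 -1},\alpha_1\circ\alpha_2)$. An anti-isomorphism is a bijection $\Theta$ with $\Theta(xy)=\Theta(y)\Theta(x)$. -}

module Defs where

open import Level using (Level; _⊔_)
open import Data.Nat using (ℕ; zero; suc; _+_; _*_)
open import Data.Fin using (Fin)
open import Data.Product using (Σ; Σ-syntax; _×_; _,_; proj₁; proj₂)
open import Relation.Nullary using (¬_)
open import Relation.Binary.Bundles using (Setoid)
open import Relation.Binary.PropositionalEquality as ≡ using (_≡_)
open import Function.Bundles using (Bijection)
open import Algebra.Bundles using (CommutativeRing; AbelianGroup)
open import Algebra.Module.Bundles using (Module)
import Algebra.Properties.Group as GroupProps
import Algebra.Properties.CommutativeSemigroup as CSProps
import Relation.Binary.Reasoning.Setoid as SetoidReasoning

Finite : ∀ {a ℓ} → Setoid a ℓ → Set (a ⊔ ℓ)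
Finite S = Σ[ n ∈ ℕ ] Bijection (≡.setoid (Fin n)) S

HasCardinality : ∀ {a ℓ} → ℕ → Setoid a ℓ → Set (a ⊔ ℓ)
HasCardinality r S = Bijection (≡.setoid (Fin r)) S

Odd : ℕ → Set
Odd r = Σ[ k ∈ ℕ ] r ≡ suc (2 * k)

module _ {c ℓc} (C : AbelianGroup c ℓc) where
  open AbelianGroup C
  mulℕ : ℕ → Carrier → Carrier
  mulℕ zero    g = ε
  mulℕ (suc k) g = g ∙ mulℕ k g

  IsCyclic : Set (c ⊔ ℓc)
  IsCyclic = Σ[ g ∈ Carrier ] (∀ x → Σ[ k ∈ ℕ ] x ≈ mulℕ k g)

module _ {r ℓr a ℓa b ℓb c ℓc} (R : CommutativeRing r ℓr)
         (A : Module R a ℓa) (B : Module R b ℓb) (C : AbelianGroup c ℓc) where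
  private
    module 𝔸 = Module A
    module 𝔹 = Module B
    module ℂ = AbelianGroup C
    module ℝ = CommutativeRing R

  record IsBilinear (lam : 𝔸.Carrierᴹ → 𝔹.Carrierᴹ → ℂ.Carrier)
         : Set (a ⊔ ℓa ⊔ b ⊔ ℓb ⊔ c ⊔ ℓc) where
    field
      cong  : ∀ {x x' y y'} → x 𝔸.≈ᴹ x' → y 𝔹.≈ᴹ y' → lam x y ℂ.≈ lam x' y'
      +-left  : ∀ x x' y → lam (x 𝔸.+ᴹ x') y ℂ.≈ (lam x y ℂ.∙ lam x' y)
      +-right : ∀ x y y' → lam x (y 𝔹.+ᴹ y') ℂ.≈ (lam x y ℂ.∙ lam x y')

  IsRBalanced : (𝔸.Carrierᴹ → 𝔹.Carrierᴹ → ℂ.Carrier) → Set (r ⊔ a ⊔ b ⊔ ℓc)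
  IsRBalanced lam = ∀ (s : ℝ.Carrier) x y → lam (s 𝔸.*ₗ x) y ℂ.≈ lam x (s 𝔹.*ₗ y)

  IsNonDegenerate : (𝔸.Carrierᴹ → 𝔹.Carrierᴹ → ℂ.Carrier) → Set (a ⊔ ℓa ⊔ b ⊔ ℓb ⊔ ℓc)
  IsNonDegenerate lam =
    (∀ x → (∀ y → lam x y ℂ.≈ ℂ.ε) → x 𝔸.≈ᴹ 𝔸.0ᴹ) ×
    (∀ y → (∀ x → lam x y ℂ.≈ ℂ.ε) → y 𝔹.≈ᴹ 𝔹.0ᴹ)

module Heisenberg {r ℓr a ℓa b ℓb c ℓc} (R : CommutativeRing r ℓr)
         (A : Module R a ℓa) (B : Module R b ℓb) (C : AbelianGroup c ℓc)
         (lam : Module.Carrierᴹ A → Module.Carrierᴹ B → AbelianGroup.Carrier C)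
         (bil : IsBilinear R A B C lam)
         -- the halving map c ↦ ½c (unique since |C| is odd)
         (half : AbelianGroup.Carrier C → AbelianGroup.Carrier C) where

  private
    module 𝔸 = Module A
    module 𝔹 = Module B
    module ℂ = AbelianGroup C
    module ℝ = CommutativeRing R
    module λB = IsBilinear bil
    module ℂP = GroupProps ℂ.group
    module ℂC = CSProps ℂ.commutativeSemigroup

  open ℂ using (_∙_; ε; _⁻¹) renaming (_≈_ to _≈C_)

  V : Set (a ⊔ b)
  V = 𝔸.Carrierᴹ × 𝔹.Carrierᴹ

  _≈V_ : V → V → Set (ℓa ⊔ ℓb)
  (x , y) ≈V (x' , y') = (x 𝔸.≈ᴹ x') × (y 𝔹.≈ᴹ y')

  _+V_ : V → V → V
  (x , y) +V (x' , y') = (x 𝔸.+ᴹ x') , (y 𝔹.+ᴹ y')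

  _·V_ : ℝ.Carrier → V → V
  s ·V (x , y) = (s 𝔸.*ₗ x) , (s 𝔹.*ₗ y)

  ≈V-refl : ∀ {v} → v ≈V v
  ≈V-refl = 𝔸.≈ᴹ-refl , 𝔹.≈ᴹ-refl
  ≈V-sym : ∀ {v w} → v ≈V w → w ≈V v
  ≈V-sym (p , q) = 𝔸.≈ᴹ-sym p , 𝔹.≈ᴹ-sym q
  ≈V-trans : ∀ {u v w} → u ≈V v → v ≈V w → u ≈V w
  ≈V-trans (p , q) (p' , q') = 𝔸.≈ᴹ-trans p p' , 𝔹.≈ᴹ-trans q q'

  V-setoid : Setoid (a ⊔ b) (ℓa ⊔ ℓb)
  V-setoid = record { Carrier = V ; _≈_ = _≈V_
    ; isEquivalence = record { refl = ≈V-refl ; sym = ≈V-sym ; trans = ≈V-trans } }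

  +V-cong : ∀ {u u' v v'} → u ≈V u' → v ≈V v' → (u +V v) ≈V (u' +V v')
  +V-cong (p , q) (p' , q') = 𝔸.+ᴹ-cong p p' , 𝔹.+ᴹ-cong q q'

  ·V-cong : ∀ s {u u'} → u ≈V u' → (s ·V u) ≈V (s ·V u')
  ·V-cong s (p , q) = 𝔸.*ₗ-congˡ p , 𝔹.*ₗ-congˡ q

  record H : Set (a ⊔ b ⊔ c) where
    constructor h
    field
      hA : 𝔸.Carrierᴹ
      hB : 𝔹.Carrierᴹ
      hC : ℂ.Carrier
  open H public

  _≈H_ : H → H → Set (ℓa ⊔ ℓb ⊔ ℓc)
  x ≈H y = (hA x 𝔸.≈ᴹ hA y) × (hB x 𝔹.≈ᴹ hB y) × (hC x ≈C hC y)

  _*H_ : H → H → H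
  h x y z *H h x' y' z' = h (x 𝔸.+ᴹ x') (y 𝔹.+ᴹ y') ((z ∙ z') ∙ lam x y')

  ≈H-refl : ∀ {x} → x ≈H x
  ≈H-refl = 𝔸.≈ᴹ-refl , 𝔹.≈ᴹ-refl , ℂ.refl
  ≈H-sym : ∀ {x y} → x ≈H y → y ≈H x
  ≈H-sym (p , q , t) = 𝔸.≈ᴹ-sym p , 𝔹.≈ᴹ-sym q , ℂ.sym t
  ≈H-trans : ∀ {x y z} → x ≈H y → y ≈H z → x ≈H z
  ≈H-trans (p , q , t) (p' , q' , t') = 𝔸.≈ᴹ-trans p p' , 𝔹.≈ᴹ-trans q q' , ℂ.trans t t'

  *H-cong : ∀ {x x' y y'} → x ≈H x' → y ≈H y' → (x *H y) ≈H (x' *H y')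
  *H-cong (p , q , t) (p' , q' , t') =
    𝔸.+ᴹ-cong p p' , 𝔹.+ᴹ-cong q q' , ℂ.∙-cong (ℂ.∙-cong t t') (λB.cong p q')

  m : ℂ.Carrier → H
  m z = h 𝔸.0ᴹ 𝔹.0ᴹ z

  𝒟 : V → H
  𝒟 (x , y) = h x y (half (lam x y))

  δ : V → V → ℂ.Carrier
  δ (x , y) (x' , y') = lam x y' ∙ (lam x' y ⁻¹)

  δ-cong : ∀ {u u' v v'} → u ≈V u' → v ≈V v' → δ u v ≈C δ u' v'
  δ-cong (p , q) (p' , q') = ℂ.∙-cong (λB.cong p q') (ℂ.⁻¹-cong (λB.cong p' q))

  -- the automorphism of H/Z = A ⊕ B induced by a map f : H → H
  -- (computed on the lift h(a,b,0) of (a,b))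
  induced : (H → H) → V → V
  induced f (x , y) = hA (f (h x y ε)) , hB (f (h x y ε))

  record Aut⁰ : Set (r ⊔ a ⊔ ℓa ⊔ b ⊔ ℓb ⊔ c ⊔ ℓc) where
    field
      to      : H → H
      from    : H → H
      to-cong   : ∀ {x y} → x ≈H y → to x ≈H to y
      from-cong : ∀ {x y} → x ≈H y → from x ≈H from y
      to-from : ∀ x → to (from x) ≈H x
      from-to : ∀ x → from (to x) ≈H x
      hom     : ∀ x y → to (x *H y) ≈H (to x *H to y)
      fixZ    : ∀ z → to (m z) ≈H m z
      bar-+   : ∀ u v → induced to (u +V v) ≈V (induced to u +V induced to v)
      bar-·   : ∀ s u → induced to (s ·V u) ≈V (s ·V induced to u)

  bar : Aut⁰ → V → V
  bar φ = induced (Aut⁰.to φ)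

  barInv : Aut⁰ → V → V
  barInv φ = induced (Aut⁰.from φ)

  -- η_φ, determined by  φ(𝒟(a)) = 𝒟(φ̄(a)) m(η_φ(a))
  η : Aut⁰ → V → ℂ.Carrier
  η φ u = hC (Aut⁰.to φ (𝒟 u)) ∙ (half (lam (proj₁ (bar φ u)) (proj₂ (bar φ u))) ⁻¹)

  _≈Aut_ : Aut⁰ → Aut⁰ → Set (a ⊔ ℓa ⊔ b ⊔ ℓb ⊔ c ⊔ ℓc)
  φ ≈Aut ψ = ∀ x → Aut⁰.to φ x ≈H Aut⁰.to ψ x

  lam-x0 : ∀ x → lam x 𝔹.0ᴹ ≈C ε
  lam-x0 x = ℂP.identityˡ-unique (lam x 𝔹.0ᴹ) (lam x 𝔹.0ᴹ)
    (ℂ.trans (ℂ.sym (λB.+-right x 𝔹.0ᴹ 𝔹.0ᴹ)) (λB.cong 𝔸.≈ᴹ-refl (𝔹.+ᴹ-identityˡ 𝔹.0ᴹ)))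

  induced-cong : ∀ (f : H → H) → (∀ {x y} → x ≈H y → f x ≈H f y) →
                 ∀ {u v} → u ≈V v → induced f u ≈V induced f v
  induced-cong f fc (p , q) with fc (p , q , ℂ.refl)
  ... | (p' , q' , _) = p' , q'

  split : ∀ x → x ≈H (h (hA x) (hB x) ε *H m (hC x))
  split x = 𝔸.≈ᴹ-sym (𝔸.+ᴹ-identityʳ _) , 𝔹.≈ᴹ-sym (𝔹.+ᴹ-identityʳ _) ,
    ℂ.sym (ℂ.trans (ℂ.∙-cong (ℂ.identityˡ _) (lam-x0 _)) (ℂ.identityʳ _))

  induced-proj : ∀ (φ : Aut⁰) x → (hA (Aut⁰.to φ x) , hB (Aut⁰.to φ x)) ≈V
                   induced (Aut⁰.to φ) (hA x , hB x)
  induced-proj φ x with ≈H-trans (Aut⁰.to-cong φ (split x))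
                         (≈H-trans (Aut⁰.hom φ _ _) (*H-cong ≈H-refl (Aut⁰.fixZ φ (hC x))))
  ... | (p , q , _) = 𝔸.≈ᴹ-trans p (𝔸.+ᴹ-identityʳ _) , 𝔹.≈ᴹ-trans q (𝔹.+ᴹ-identityʳ _)

  induced-∘ : ∀ (φ ψ : Aut⁰) u →
    induced (λ x → Aut⁰.to φ (Aut⁰.to ψ x)) u ≈V induced (Aut⁰.to φ) (induced (Aut⁰.to ψ) u)
  induced-∘ φ ψ (x , y) = induced-proj φ (Aut⁰.to ψ (h x y ε))

  _∘Aut_ : Aut⁰ → Aut⁰ → Aut⁰
  φ ∘Aut ψ = record
    { to = λ x → φ.to (ψ.to x)
    ; from = λ x → ψ.from (φ.from x)
    ; to-cong = λ e → φ.to-cong (ψ.to-cong e)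
    ; from-cong = λ e → ψ.from-cong (φ.from-cong e)
    ; to-from = λ x → ≈H-trans (φ.to-cong (ψ.to-from _)) (φ.to-from x)
    ; from-to = λ x → ≈H-trans (ψ.from-cong (φ.from-to _)) (ψ.from-to x)
    ; hom = λ x y → ≈H-trans (φ.to-cong (ψ.hom x y)) (φ.hom _ _)
    ; fixZ = λ z → ≈H-trans (φ.to-cong (ψ.fixZ z)) (φ.fixZ z)
    ; bar-+ = λ u v → ≈V-trans (induced-∘ φ ψ _)
        (≈V-trans (induced-cong φ.to φ.to-cong (ψ.bar-+ u v))
        (≈V-trans (φ.bar-+ _ _) (+V-cong (≈V-sym (induced-∘ φ ψ u)) (≈V-sym (induced-∘ φ ψ v)))))
    ; bar-· = λ s u → ≈V-trans (induced-∘ φ ψ _)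
        (≈V-trans (induced-cong φ.to φ.to-cong (ψ.bar-· s u))
        (≈V-trans (φ.bar-· _ _) (·V-cong s (≈V-sym (induced-∘ φ ψ u)))))
    }
    where module φ = Aut⁰ φ
          module ψ = Aut⁰ ψ

  record IsSp (f g : V → V) : Set (r ⊔ a ⊔ ℓa ⊔ b ⊔ ℓb ⊔ ℓc) where
    field
      f-cong : ∀ {u v} → u ≈V v → f u ≈V f v
      g-cong : ∀ {u v} → u ≈V v → g u ≈V g v
      f∘g    : ∀ u → f (g u) ≈V u
      g∘f    : ∀ u → g (f u) ≈V u
      f-+    : ∀ u v → f (u +V v) ≈V (f u +V f v)
      f-·    : ∀ s u → f (s ·V u) ≈V (s ·V f u)
      f-δ    : ∀ u v → δ (f u) (f v) ≈C δ u v

  record Sp : Set (r ⊔ a ⊔ ℓa ⊔ b ⊔ ℓb ⊔ ℓc) where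
    field
      fun  : V → V
      inv  : V → V
      isSp : IsSp fun inv
    open IsSp isSp public

  _≈Sp_ : Sp → Sp → Set (a ⊔ ℓa ⊔ b ⊔ ℓb)
  α ≈Sp β = ∀ u → Sp.fun α u ≈V Sp.fun β u

  _∘Sp_ : Sp → Sp → Sp
  α ∘Sp β = record
    { fun = λ u → α.fun (β.fun u)
    ; inv = λ u → β.inv (α.inv u)
    ; isSp = record
      { f-cong = λ e → α.f-cong (β.f-cong e)
      ; g-cong = λ e → β.g-cong (α.g-cong e)
      ; f∘g = λ u → ≈V-trans (α.f-cong (β.f∘g _)) (α.f∘g u)
      ; g∘f = λ u → ≈V-trans (β.g-cong (α.g∘f _)) (β.g∘f u)
      ; f-+ = λ u v → ≈V-trans (α.f-cong (β.f-+ u v)) (α.f-+ _ _)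
      ; f-· = λ s u → ≈V-trans (α.f-cong (β.f-· s u)) (α.f-· s _)
      ; f-δ = λ u v → ℂ.trans (α.f-δ _ _) (β.f-δ u v)
      } }
    where module α = Sp α
          module β = Sp β

  spInv : Sp → Sp
  spInv α = record
    { fun = α.inv
    ; inv = α.fun
    ; isSp = record
      { f-cong = α.g-cong
      ; g-cong = α.f-cong
      ; f∘g = α.g∘f
      ; g∘f = α.f∘g
      ; f-+ = λ u v → ≈V-trans (α.g-cong (+V-cong (≈V-sym (α.f∘g u)) (≈V-sym (α.f∘g v))))
                      (≈V-trans (α.g-cong (≈V-sym (α.f-+ _ _))) (α.g∘f _))
      ; f-· = λ s u → ≈V-trans (α.g-cong (·V-cong s (≈V-sym (α.f∘g u))))
                      (≈V-trans (α.g-cong (≈V-sym (α.f-· s _))) (α.g∘f _))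
      ; f-δ = λ u v → ℂ.trans (ℂ.sym (α.f-δ _ _)) (δ-cong (α.f∘g u) (α.f∘g v))
      } }
    where module α = Sp α

  record IsHom (f : V → ℂ.Carrier) : Set (a ⊔ ℓa ⊔ b ⊔ ℓb ⊔ ℓc) where
    field
      cong : ∀ {u v} → u ≈V v → f u ≈C f v
      hom  : ∀ u v → f (u +V v) ≈C (f u ∙ f v)

  record Hom : Set (a ⊔ ℓa ⊔ b ⊔ ℓb ⊔ c ⊔ ℓc) where
    field
      fun   : V → ℂ.Carrier
      isHom : IsHom fun
    open IsHom isHom public

  _≈Hom_ : Hom → Hom → Set (a ⊔ b ⊔ ℓc)
  η₁ ≈Hom η₂ = ∀ u → Hom.fun η₁ u ≈C Hom.fun η₂ u

  SD : Set (r ⊔ a ⊔ ℓa ⊔ b ⊔ ℓb ⊔ c ⊔ ℓc)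
  SD = Hom × Sp

  _≈SD_ : SD → SD → Set (a ⊔ ℓa ⊔ b ⊔ ℓb ⊔ ℓc)
  (η₁ , α₁) ≈SD (η₂ , α₂) = (η₁ ≈Hom η₂) × (α₁ ≈Sp α₂)

  _·SD_ : SD → SD → SD
  (η₁ , α₁) ·SD (η₂ , α₂) = record
      { fun = λ u → η₁.fun u ∙ η₂.fun (α₁.inv u)
      ; isHom = record
        { cong = λ e → ℂ.∙-cong (η₁.cong e) (η₂.cong (α₁.g-cong e))
        ; hom = λ u v → ℂ.trans
            (ℂ.∙-cong (η₁.hom u v)
              (ℂ.trans (η₂.cong (Sp.f-+ (spInv α₁) u v)) (η₂.hom _ _)))
            (ℂC.interchange _ _ _ _)
        } }
    , (α₁ ∘Sp α₂)
    where module η₁ = Hom η₁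
          module η₂ = Hom η₂
          module α₁ = Sp α₁

  Θ : (∀ φ → IsHom (η φ)) → (∀ φ → IsSp (bar φ) (barInv φ)) → Aut⁰ → SD
  Θ ηHom barSp φ =
    record { fun = η φ ; isHom = ηHom φ } ,
    spInv (record { fun = bar φ ; inv = barInv φ ; isSp = barSp φ })

  record IsAntiIso (F : Aut⁰ → SD) : Set (r ⊔ a ⊔ ℓa ⊔ b ⊔ ℓb ⊔ c ⊔ ℓc) where
    field
      cong       : ∀ {φ ψ} → φ ≈Aut ψ → F φ ≈SD F ψ
      injective  : ∀ {φ ψ} → F φ ≈SD F ψ → φ ≈Aut ψ
      surjective : ∀ y → Σ[ φ ∈ Aut⁰ ] F φ ≈SD y
      anti-hom   : ∀ φ ψ → F (φ ∘Aut ψ) ≈SD (F ψ ·SD F φ)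

{-# OPTIONS --safe #-}
-- Every element of H is uniquely 𝒟(u) m(z) with u ∈ A ⊕ B, and in these coordinates
-- (u , z) (v , w) = (u + v , z + w + ½δ(u , v)); this uses that halving is additive, which holds
-- because in a cyclic group a halving map is multiplication by a fixed natural number.
-- An automorphism fixing the centre acts by (u , z) ↦ (φ̄ u , z + η_φ(u)). Comparing commutators
-- shows that φ̄ preserves δ, and computing φ(𝒟(u) 𝒟(v)) in two ways then shows that η_φ is
-- additive. Conversely (u , z) ↦ (α⁻¹ u , z + η(u)) is such an automorphism for every (η , α),
-- which gives surjectivity; injectivity and the anti-homomorphism law are read off the formula.
module Submission where

open import Level using (_⊔_)
open import Data.Nat using (ℕ; zero; suc; _+_; _*_)
open import Data.Nat.Properties using (*-comm)
open import Data.Product using (Σ-syntax; _×_; _,_; proj₁; proj₂)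
open import Relation.Nullary using (¬_)
open import Algebra.Bundles using (CommutativeRing; AbelianGroup)
open import Algebra.Module.Bundles using (Module)
import Algebra.Properties.Group as GroupProperties
open import Defs

module Halving {g ℓ} (G : AbelianGroup g ℓ) (cyclic : IsCyclic G)
  (half : AbelianGroup.Carrier G → AbelianGroup.Carrier G)
  (half-double : ∀ z → AbelianGroup._≈_ G (AbelianGroup._∙_ G (half z) (half z)) z) where

  open AbelianGroup G
  open import Algebra.Properties.AbelianGroup G using (\\-leftDividesʳ)
  open import Algebra.Properties.CommutativeMonoid.Mult commutativeMonoid
    using (×-congʳ; ×-congˡ; ×-homo-+; ×-assocˡ; ×-distrib-+) renaming (_×_ to _·_)
  open import Relation.Binary.Reasoning.Setoid setoid

  mulℕ≈· : ∀ n x → mulℕ G n x ≈ n · x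
  mulℕ≈· zero    x = refl
  mulℕ≈· (suc n) x = ∙-congˡ (mulℕ≈· n x)

  private
    generator : Carrier
    generator = proj₁ cyclic

    power : Carrier → ℕ
    power x = proj₁ (proj₂ cyclic x)

    x≈power·generator : ∀ x → x ≈ power x · generator
    x≈power·generator x = trans (proj₂ (proj₂ cyclic x)) (mulℕ≈· (power x) generator)

    k : ℕ
    k = power (half generator)

  -- 2k ≡ 1 modulo the order of the generator, hence modulo the order of every element.
  double-k·-fixes : ∀ x → (k + k) · x ≈ x
  double-k·-fixes x = begin
    (k + k) · x                ≈⟨ ×-congʳ (k + k) (x≈power·generator x) ⟩
    (k + k) · (j · generator)  ≈⟨ ×-assocˡ generator (k + k) j ⟩
    ((k + k) * j) · generator  ≈⟨ ×-congˡ (*-comm (k + k) j) ⟩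
    (j * (k + k)) · generator  ≈⟨ ×-assocˡ generator j (k + k) ⟨
    j · ((k + k) · generator)  ≈⟨ ×-congʳ j double-k·-fixes-generator ⟩
    j · generator              ≈⟨ x≈power·generator x ⟨
    x                          ∎
    where
    j = power x
    double-k·-fixes-generator : (k + k) · generator ≈ generator
    double-k·-fixes-generator = begin
      (k + k) · generator              ≈⟨ ×-homo-+ generator k k ⟩
      k · generator ∙ k · generator    ≈⟨ ∙-cong k·g k·g ⟨
      half generator ∙ half generator  ≈⟨ half-double generator ⟩
      generator                        ∎
      where k·g = x≈power·generator (half generator)

  k·-double : ∀ x → k · (x ∙ x) ≈ x
  k·-double x = trans (×-distrib-+ x x k) (trans (sym (×-homo-+ x k k)) (double-k·-fixes x))

  half≈k· : ∀ z → half z ≈ k · z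
  half≈k· z = trans (sym (k·-double (half z))) (×-congʳ k (half-double z))

  half-cong : ∀ {x y} → x ≈ y → half x ≈ half y
  half-cong {x} {y} x≈y = trans (half≈k· x) (trans (×-congʳ k x≈y) (sym (half≈k· y)))

  half-∙ : ∀ x y → half (x ∙ y) ≈ half x ∙ half y
  half-∙ x y = trans (half≈k· (x ∙ y))
    (trans (×-distrib-+ x y k) (sym (∙-cong (half≈k· x) (half≈k· y))))

  half-∙-self : ∀ x → half (x ∙ x) ≈ x
  half-∙-self x = trans (half≈k· (x ∙ x)) (k·-double x)

  half-ε : half ε ≈ ε
  half-ε = trans (half-cong (sym (identityˡ ε))) (half-∙-self ε)

  half-flip : ∀ x → half x ≈ half (x ⁻¹) ∙ x
  half-flip x = begin
    half x                      ≈⟨ half-cong (\\-leftDividesʳ x x) ⟨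
    half (x ⁻¹ ∙ (x ∙ x))       ≈⟨ half-∙ (x ⁻¹) (x ∙ x) ⟩
    half (x ⁻¹) ∙ half (x ∙ x)  ≈⟨ ∙-congˡ (half-∙-self x) ⟩
    half (x ⁻¹) ∙ x             ∎

  half-polar : ∀ x y → half (x - y) ∙ half (x ∙ y) ≈ x
  half-polar x y = begin
    half (x - y) ∙ half (x ∙ y)  ≈⟨ half-∙ (x - y) (x ∙ y) ⟨
    half ((x - y) ∙ (x ∙ y))     ≈⟨ half-cong (∙-congˡ (comm x y)) ⟩
    half ((x - y) ∙ (y ∙ x))     ≈⟨ half-cong (assoc x (y ⁻¹) (y ∙ x)) ⟩
    half (x ∙ (y ⁻¹ ∙ (y ∙ x)))  ≈⟨ half-cong (∙-congˡ (\\-leftDividesʳ y x)) ⟩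
    half (x ∙ x)                 ≈⟨ half-∙-self x ⟩
    x                            ∎

module HeisenbergAutomorphisms {r ℓr a ℓa b ℓb c ℓc}
  (R : CommutativeRing r ℓr) (A : Module R a ℓa) (B : Module R b ℓb)
  (C : AbelianGroup c ℓc) (cyclic : IsCyclic C)
  (lam : Module.Carrierᴹ A → Module.Carrierᴹ B → AbelianGroup.Carrier C)
  (bil : IsBilinear R A B C lam)
  (half : AbelianGroup.Carrier C → AbelianGroup.Carrier C)
  (half-double : ∀ z → AbelianGroup._≈_ C (AbelianGroup._∙_ C (half z) (half z)) z) where

  open Heisenberg R A B C lam bil half
  open Halving C cyclic half half-double
  open AbelianGroup C
  open import Algebra.Properties.AbelianGroup C
    using (xyx⁻¹≈y; //-rightDividesˡ; ⁻¹-anti-homo‿-; ε⁻¹≈ε; identityˡ-unique; ∙-cancelˡ; ∙-cancelʳ)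
  open import Algebra.Solver.CommutativeMonoid commutativeMonoid using (solve; _⊜_; _⊕_)
  open import Relation.Binary.Reasoning.Setoid setoid
  private
    module 𝔸 = Module A
    module 𝔹 = Module B
    module λB = IsBilinear bil

  0V : V
  0V = 𝔸.0ᴹ , 𝔹.0ᴹ

  +V-identityʳ : ∀ u → (u +V 0V) ≈V u
  +V-identityʳ u = 𝔸.+ᴹ-identityʳ (proj₁ u) , 𝔹.+ᴹ-identityʳ (proj₂ u)

  +V-comm : ∀ u v → (u +V v) ≈V (v +V u)
  +V-comm u v = 𝔸.+ᴹ-comm (proj₁ u) (proj₁ v) , 𝔹.+ᴹ-comm (proj₂ u) (proj₂ v)

  π : H → V
  π x = hA x , hB x

  π-cong : ∀ {x y} → x ≈H y → π x ≈V π y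
  π-cong (p , q , _) = p , q

  ½Λ : V → Carrier
  ½Λ u = half (lam (proj₁ u) (proj₂ u))

  ½Λ-cong : ∀ {u v} → u ≈V v → ½Λ u ≈ ½Λ v
  ½Λ-cong (p , q) = half-cong (λB.cong p q)

  σ : H → Carrier
  σ x = hC x - ½Λ (π x)

  σ-cong : ∀ {x y} → x ≈H y → σ x ≈ σ y
  σ-cong (p , q , t) = ∙-cong t (⁻¹-cong (½Λ-cong (p , q)))

  σ∙½Λ : ∀ x → σ x ∙ ½Λ (π x) ≈ hC x
  σ∙½Λ x = //-rightDividesˡ (½Λ (π x)) (hC x)

  π-σ-injective : ∀ {x y} → π x ≈V π y → σ x ≈ σ y → x ≈H y
  π-σ-injective {x} {y} (p , q) σx≈σy = p , q , (begin
    hC x             ≈⟨ σ∙½Λ x ⟨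
    σ x ∙ ½Λ (π x)   ≈⟨ ∙-cong σx≈σy (½Λ-cong (p , q)) ⟩
    σ y ∙ ½Λ (π y)   ≈⟨ σ∙½Λ y ⟩
    hC y             ∎)

  fromCoordinates : V → Carrier → H
  fromCoordinates u z = h (proj₁ u) (proj₂ u) (½Λ u ∙ z)

  fromCoordinates-cong : ∀ {u v z w} → u ≈V v → z ≈ w → fromCoordinates u z ≈H fromCoordinates v w
  fromCoordinates-cong (p , q) z≈w = p , q , ∙-cong (½Λ-cong (p , q)) z≈w

  σ-fromCoordinates : ∀ u z → σ (fromCoordinates u z) ≈ z
  σ-fromCoordinates u z = xyx⁻¹≈y (½Λ u) z

  σ-𝒟 : ∀ u → σ (𝒟 u) ≈ ε
  σ-𝒟 u = inverseʳ (½Λ u)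

  σ-m : ∀ z → σ (m z) ≈ z
  σ-m z = begin
    z - half (lam 𝔸.0ᴹ 𝔹.0ᴹ)  ≈⟨ ∙-congˡ (⁻¹-cong (trans (half-cong (lam-x0 𝔸.0ᴹ)) half-ε)) ⟩
    z ∙ ε ⁻¹                  ≈⟨ ∙-congˡ ε⁻¹≈ε ⟩
    z ∙ ε                     ≈⟨ identityʳ z ⟩
    z                         ∎

  ½Λ-+ : ∀ u v → ½Λ (u +V v) ≈
         (½Λ u ∙ ½Λ v) ∙ half (lam (proj₁ u) (proj₂ v) ∙ lam (proj₁ v) (proj₂ u))
  ½Λ-+ (x , y) (x' , y') = begin
    half (lam (x 𝔸.+ᴹ x') (y 𝔹.+ᴹ y'))
      ≈⟨ half-cong (trans (λB.+-left x x' _) (∙-cong (λB.+-right x y y') (λB.+-right x' y y'))) ⟩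
    half ((lam x y ∙ lam x y') ∙ (lam x' y ∙ lam x' y'))
      ≈⟨ half-cong (solve 4 (λ p q s t → (p ⊕ q) ⊕ (s ⊕ t) ⊜ (p ⊕ t) ⊕ (q ⊕ s)) refl _ _ _ _) ⟩
    half ((lam x y ∙ lam x' y') ∙ (lam x y' ∙ lam x' y))
      ≈⟨ trans (half-∙ _ _) (∙-congʳ (half-∙ _ _)) ⟩
    (half (lam x y) ∙ half (lam x' y')) ∙ half (lam x y' ∙ lam x' y) ∎

  σ-*H : ∀ x y → σ (x *H y) ≈ (σ x ∙ σ y) ∙ half (δ (π x) (π y))
  σ-*H x y = ∙-cancelʳ (½Λ (π x +V π y)) _ _ (begin
    σ (x *H y) ∙ ½Λ (π x +V π y)
      ≈⟨ σ∙½Λ (x *H y) ⟩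
    (hC x ∙ hC y) ∙ p
      ≈⟨ ∙-cong (∙-cong (σ∙½Λ x) (σ∙½Λ y)) (half-polar p q) ⟨
    ((σ x ∙ ½Λ (π x)) ∙ (σ y ∙ ½Λ (π y))) ∙ (half (p - q) ∙ half (p ∙ q))
      ≈⟨ solve 6 (λ s s' l l' d e → ((s ⊕ l) ⊕ (s' ⊕ l')) ⊕ (d ⊕ e) ⊜ ((s ⊕ s') ⊕ d) ⊕ ((l ⊕ l') ⊕ e))
           refl _ _ _ _ _ _ ⟩
    ((σ x ∙ σ y) ∙ half (p - q)) ∙ ((½Λ (π x) ∙ ½Λ (π y)) ∙ half (p ∙ q))
      ≈⟨ ∙-congˡ (½Λ-+ (π x) (π y)) ⟨
    ((σ x ∙ σ y) ∙ half (δ (π x) (π y))) ∙ ½Λ (π x +V π y) ∎)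
    where
    p = lam (hA x) (hB y)
    q = lam (hA y) (hB x)

  σ-*m : ∀ x z → σ (x *H m z) ≈ σ x ∙ z
  σ-*m x z = begin
    ((hC x ∙ z) ∙ lam (hA x) 𝔹.0ᴹ) - ½Λ (π x +V 0V)
      ≈⟨ ∙-cong (trans (∙-congˡ (lam-x0 (hA x))) (identityʳ _)) (⁻¹-cong (½Λ-cong (+V-identityʳ (π x)))) ⟩
    (hC x ∙ z) - ½Λ (π x)
      ≈⟨ solve 3 (λ s t l → (s ⊕ t) ⊕ l ⊜ (s ⊕ l) ⊕ t) refl _ _ _ ⟩
    σ x ∙ z ∎

  σ-comm : ∀ x y → σ (x *H y) ≈ σ (y *H x) ∙ δ (π x) (π y)
  σ-comm x y = begin
    σ (x *H y)                                       ≈⟨ σ-*H x y ⟩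
    (σ x ∙ σ y) ∙ half d                             ≈⟨ ∙-cong (comm (σ x) (σ y)) (half-flip d) ⟩
    (σ y ∙ σ x) ∙ (half (d ⁻¹) ∙ d)                  ≈⟨ ∙-congˡ (∙-congʳ (half-cong (⁻¹-anti-homo‿- _ _))) ⟩
    (σ y ∙ σ x) ∙ (half (δ (π y) (π x)) ∙ d)         ≈⟨ assoc _ _ _ ⟨
    ((σ y ∙ σ x) ∙ half (δ (π y) (π x))) ∙ d         ≈⟨ ∙-congʳ (σ-*H y x) ⟨
    σ (y *H x) ∙ d                                   ∎
    where d = δ (π x) (π y)

  ≈𝒟*m : ∀ {x u z} → π x ≈V u → σ x ≈ z → x ≈H (𝒟 u *H m z)
  ≈𝒟*m {x} {u} {z} πx≈u σx≈z = π-σ-injective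
    (≈V-trans πx≈u (≈V-sym (+V-identityʳ u)))
    (trans σx≈z (sym (trans (σ-*m (𝒟 u) z) (trans (∙-congʳ (σ-𝒟 u)) (identityˡ z)))))

  𝒟*m-decomposition : ∀ x → x ≈H (𝒟 (π x) *H m (σ x))
  𝒟*m-decomposition x = ≈𝒟*m ≈V-refl refl

  record IsCentralEndo (f : H → H) : Set (a ⊔ ℓa ⊔ b ⊔ ℓb ⊔ c ⊔ ℓc) where
    field
      cong : ∀ {x y} → x ≈H y → f x ≈H f y
      hom  : ∀ x y → f (x *H y) ≈H (f x *H f y)
      fixZ : ∀ z → f (m z) ≈H m z

  module CentralEndo {f : H → H} (isCentralEndo : IsCentralEndo f) where
    open IsCentralEndo isCentralEndo

    f-*m : ∀ x z → f (x *H m z) ≈H (f x *H m z)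
    f-*m x z = ≈H-trans (hom x (m z)) (*H-cong ≈H-refl (fixZ z))

    π-f : ∀ x → π (f x) ≈V induced f (π x)
    π-f x = ≈V-trans (π-cong (≈H-trans (cong (split x)) (f-*m _ (hC x)))) (+V-identityʳ _)

    σ-f : ∀ x → σ (f x) ≈ σ (f (𝒟 (π x))) ∙ σ x
    σ-f x = trans (σ-cong (≈H-trans (cong (𝒟*m-decomposition x)) (f-*m _ (σ x)))) (σ-*m _ (σ x))

  module Aut⁰-Properties (φ : Aut⁰) where
    open Aut⁰ φ

    to-central : IsCentralEndo to
    to-central = record { cong = to-cong ; hom = hom ; fixZ = fixZ }

    from-central : IsCentralEndo from
    from-central = record
      { cong = from-cong
      ; hom  = λ x y → ≈H-trans (from-cong (*H-cong (≈H-sym (to-from x)) (≈H-sym (to-from y))))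
                         (≈H-trans (from-cong (≈H-sym (hom _ _))) (from-to _))
      ; fixZ = λ z → ≈H-trans (from-cong (≈H-sym (fixZ z))) (from-to (m z))
      }

    module To = CentralEndo to-central
    module From = CentralEndo from-central

    bar-cong : ∀ {u v} → u ≈V v → bar φ u ≈V bar φ v
    bar-cong = induced-cong to to-cong

    η≈σ : ∀ u → η φ u ≈ σ (to (𝒟 u))
    η≈σ u = ∙-congˡ (⁻¹-cong (½Λ-cong (≈V-sym (To.π-f (𝒟 u)))))

    σ-to : ∀ x → σ (to x) ≈ η φ (π x) ∙ σ x
    σ-to x = trans (To.σ-f x) (∙-congʳ (sym (η≈σ (π x))))

    σ-to-*H : ∀ x y → σ (to x *H to y) ≈ η φ (π x +V π y) ∙ σ (x *H y)
    σ-to-*H x y = trans (σ-cong (≈H-sym (hom x y))) (σ-to (x *H y))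

    𝒟-image : ∀ u → to (𝒟 u) ≈H (𝒟 (bar φ u) *H m (η φ u))
    𝒟-image u = ≈𝒟*m (To.π-f (𝒟 u)) (sym (η≈σ u))

    η-cong : ∀ {u v} → u ≈V v → η φ u ≈ η φ v
    η-cong {u} {v} u≈v = trans (η≈σ u) (trans (σ-cong (to-cong 𝒟u≈𝒟v)) (sym (η≈σ v)))
      where 𝒟u≈𝒟v = proj₁ u≈v , proj₂ u≈v , ½Λ-cong u≈v

    -- φ preserves commutators, and the commutator of x and y is m(δ(π x, π y)).
    bar-δ : ∀ u v → δ (bar φ u) (bar φ v) ≈ δ u v
    bar-δ u v = ∙-cancelˡ t _ _ (begin
      t ∙ δ (bar φ u) (bar φ v)
        ≈⟨ ∙-cong (trans (∙-congʳ (η-cong (+V-comm u v))) (sym (σ-to-*H y x)))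
                  (δ-cong (≈V-sym (To.π-f x)) (≈V-sym (To.π-f y))) ⟩
      σ (to y *H to x) ∙ δ (π (to x)) (π (to y))  ≈⟨ σ-comm (to x) (to y) ⟨
      σ (to x *H to y)                            ≈⟨ σ-to-*H x y ⟩
      η φ (u +V v) ∙ σ (x *H y)                   ≈⟨ ∙-congˡ (σ-comm x y) ⟩
      η φ (u +V v) ∙ (σ (y *H x) ∙ δ u v)         ≈⟨ assoc _ _ _ ⟨
      t ∙ δ u v                                   ∎)
      where
      x = 𝒟 u
      y = 𝒟 v
      t = η φ (u +V v) ∙ σ (y *H x)

    η-hom : ∀ u v → η φ (u +V v) ≈ η φ u ∙ η φ v
    η-hom u v = ∙-cancelʳ (half (δ u v)) _ _ (begin
      η φ (u +V v) ∙ half (δ u v)       ≈⟨ ∙-congˡ σ-𝒟*𝒟 ⟨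
      η φ (u +V v) ∙ σ (𝒟 u *H 𝒟 v)     ≈⟨ σ-to-*H (𝒟 u) (𝒟 v) ⟨
      σ (to (𝒟 u) *H to (𝒟 v))          ≈⟨ σ-*H (to (𝒟 u)) (to (𝒟 v)) ⟩
      (σ (to (𝒟 u)) ∙ σ (to (𝒟 v))) ∙ half (δ (π (to (𝒟 u))) (π (to (𝒟 v))))
        ≈⟨ ∙-cong (∙-cong (sym (η≈σ u)) (sym (η≈σ v)))
                  (half-cong (trans (δ-cong (To.π-f (𝒟 u)) (To.π-f (𝒟 v))) (bar-δ u v))) ⟩
      (η φ u ∙ η φ v) ∙ half (δ u v)     ∎)
      where
      σ-𝒟*𝒟 : σ (𝒟 u *H 𝒟 v) ≈ half (δ u v)
      σ-𝒟*𝒟 = trans (σ-*H (𝒟 u) (𝒟 v))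
        (trans (∙-congʳ (trans (∙-cong (σ-𝒟 u) (σ-𝒟 v)) (identityˡ ε))) (identityˡ _))

    bar-barInv : ∀ u → bar φ (barInv φ u) ≈V u
    bar-barInv u = ≈V-trans (≈V-sym (To.π-f (from x))) (π-cong (to-from x))
      where x = h (proj₁ u) (proj₂ u) ε

    barInv-bar : ∀ u → barInv φ (bar φ u) ≈V u
    barInv-bar u = ≈V-trans (≈V-sym (From.π-f (to x))) (π-cong (from-to x))
      where x = h (proj₁ u) (proj₂ u) ε

    isSp : IsSp (bar φ) (barInv φ)
    isSp = record
      { f-cong = bar-cong
      ; g-cong = induced-cong from from-cong
      ; f∘g    = bar-barInv
      ; g∘f    = barInv-bar
      ; f-+    = bar-+
      ; f-·    = bar-·
      ; f-δ    = bar-δ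
      }

    isHom : IsHom (η φ)
    isHom = record { cong = η-cong ; hom = η-hom }

  ηHom : ∀ φ → IsHom (η φ)
  ηHom = Aut⁰-Properties.isHom

  barSp : ∀ φ → IsSp (bar φ) (barInv φ)
  barSp = Aut⁰-Properties.isSp

  ≈Aut⇒from≈ : ∀ {φ ψ} → φ ≈Aut ψ → ∀ x → Aut⁰.from φ x ≈H Aut⁰.from ψ x
  ≈Aut⇒from≈ {φ} {ψ} φ≈ψ x = ≈H-trans (≈H-sym (ψ.from-to _))
    (≈H-trans (ψ.from-cong (≈H-sym (φ≈ψ _))) (ψ.from-cong (φ.to-from x)))
    where
    module φ = Aut⁰ φ
    module ψ = Aut⁰ ψ

  Θ-cong : ∀ {φ ψ} → φ ≈Aut ψ → Θ ηHom barSp φ ≈SD Θ ηHom barSp ψ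
  Θ-cong {φ} {ψ} φ≈ψ =
    (λ u → trans (η≈σ φ u) (trans (σ-cong (φ≈ψ (𝒟 u))) (sym (η≈σ ψ u)))) ,
    (λ u → π-cong (≈Aut⇒from≈ {φ} {ψ} φ≈ψ (h (proj₁ u) (proj₂ u) ε)))
    where open Aut⁰-Properties using (η≈σ)

  Θ-injective : ∀ {φ ψ} → Θ ηHom barSp φ ≈SD Θ ηHom barSp ψ → φ ≈Aut ψ
  Θ-injective {φ} {ψ} (η≈ , barInv≈) x = π-σ-injective
    (≈V-trans (φ.To.π-f x) (≈V-trans (bar≈ (π x)) (≈V-sym (ψ.To.π-f x))))
    (trans (φ.σ-to x) (trans (∙-congʳ (η≈ (π x))) (sym (ψ.σ-to x))))
    where
    module φ = Aut⁰-Properties φ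
    module ψ = Aut⁰-Properties ψ
    bar≈ : ∀ u → bar φ u ≈V bar ψ u
    bar≈ u = ≈V-trans (φ.bar-cong (≈V-sym (ψ.barInv-bar u)))
      (≈V-trans (φ.bar-cong (≈V-sym (barInv≈ (bar ψ u)))) (φ.bar-barInv (bar ψ u)))

  Θ-anti-hom : ∀ φ ψ → Θ ηHom barSp (φ ∘Aut ψ) ≈SD (Θ ηHom barSp ψ ·SD Θ ηHom barSp φ)
  Θ-anti-hom φ ψ = η-∘ , (λ u → ψ.From.π-f (Aut⁰.from φ (h (proj₁ u) (proj₂ u) ε)))
    where
    module φ = Aut⁰-Properties φ
    module ψ = Aut⁰-Properties ψ
    η-∘ : ∀ u → η (φ ∘Aut ψ) u ≈ η ψ u ∙ η φ (bar ψ u)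
    η-∘ u = begin
      η (φ ∘Aut ψ) u                                   ≈⟨ Aut⁰-Properties.η≈σ (φ ∘Aut ψ) u ⟩
      σ (Aut⁰.to φ (Aut⁰.to ψ (𝒟 u)))                  ≈⟨ φ.σ-to _ ⟩
      η φ (π (Aut⁰.to ψ (𝒟 u))) ∙ σ (Aut⁰.to ψ (𝒟 u))  ≈⟨ ∙-cong (φ.η-cong (ψ.To.π-f (𝒟 u))) (sym (ψ.η≈σ u)) ⟩
      η φ (bar ψ u) ∙ η ψ u                            ≈⟨ comm _ _ ⟩
      η ψ u ∙ η φ (bar ψ u)                            ∎

  module Θ-Preimage (η₀ : Hom) (α : Sp) where
    private
      module η₀ = Hom η₀
      module α = Sp α
      module β = Sp (spInv α)
      module 𝔸G = GroupProperties 𝔸.+ᴹ-group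
      module 𝔹G = GroupProperties 𝔹.+ᴹ-group

    to : H → H
    to x = fromCoordinates (β.fun (π x)) (η₀.fun (π x) ∙ σ x)

    from : H → H
    from x = fromCoordinates (α.fun (π x)) (σ x - η₀.fun (α.fun (π x)))

    to-cong : ∀ {x y} → x ≈H y → to x ≈H to y
    to-cong x≈y = fromCoordinates-cong (β.f-cong (π-cong x≈y)) (∙-cong (η₀.cong (π-cong x≈y)) (σ-cong x≈y))

    from-cong : ∀ {x y} → x ≈H y → from x ≈H from y
    from-cong x≈y = fromCoordinates-cong αx≈αy (∙-cong (σ-cong x≈y) (⁻¹-cong (η₀.cong αx≈αy)))
      where αx≈αy = α.f-cong (π-cong x≈y)

    to-from : ∀ x → to (from x) ≈H x
    to-from x = π-σ-injective (β.f∘g (π x)) (begin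
      σ (to (from x))                                          ≈⟨ σ-fromCoordinates _ _ ⟩
      η₀.fun (α.fun (π x)) ∙ σ (from x)                        ≈⟨ ∙-congˡ (σ-fromCoordinates _ _) ⟩
      η₀.fun (α.fun (π x)) ∙ (σ x - η₀.fun (α.fun (π x)))      ≈⟨ comm _ _ ⟩
      (σ x - η₀.fun (α.fun (π x))) ∙ η₀.fun (α.fun (π x))      ≈⟨ //-rightDividesˡ _ _ ⟩
      σ x                                                      ∎)

    from-to : ∀ x → from (to x) ≈H x
    from-to x = π-σ-injective (β.g∘f (π x)) (begin
      σ (from (to x))                                          ≈⟨ σ-fromCoordinates _ _ ⟩
      σ (to x) - η₀.fun (α.fun (β.fun (π x)))
        ≈⟨ ∙-cong (σ-fromCoordinates _ _) (⁻¹-cong (η₀.cong (β.g∘f (π x)))) ⟩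
      (η₀.fun (π x) ∙ σ x) - η₀.fun (π x)                      ≈⟨ xyx⁻¹≈y _ _ ⟩
      σ x                                                      ∎)

    to-hom : ∀ x y → to (x *H y) ≈H (to x *H to y)
    to-hom x y = π-σ-injective (β.f-+ (π x) (π y)) (begin
      σ (to (x *H y))                                     ≈⟨ σ-fromCoordinates _ _ ⟩
      η₀.fun (π x +V π y) ∙ σ (x *H y)                    ≈⟨ ∙-cong (η₀.hom (π x) (π y)) (σ-*H x y) ⟩
      (η₀.fun (π x) ∙ η₀.fun (π y)) ∙ ((σ x ∙ σ y) ∙ half (δ (π x) (π y)))
        ≈⟨ solve 5 (λ e e' s s' d → (e ⊕ e') ⊕ ((s ⊕ s') ⊕ d) ⊜ ((e ⊕ s) ⊕ (e' ⊕ s')) ⊕ d) refl _ _ _ _ _ ⟩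
      ((η₀.fun (π x) ∙ σ x) ∙ (η₀.fun (π y) ∙ σ y)) ∙ half (δ (π x) (π y))
        ≈⟨ ∙-cong (∙-cong (σ-fromCoordinates _ _) (σ-fromCoordinates _ _))
                  (half-cong (β.f-δ (π x) (π y))) ⟨
      (σ (to x) ∙ σ (to y)) ∙ half (δ (π (to x)) (π (to y)))  ≈⟨ σ-*H (to x) (to y) ⟨
      σ (to x *H to y)                                    ∎)

    to-fixZ : ∀ z → to (m z) ≈H m z
    to-fixZ z = π-σ-injective β-0 (begin
      σ (to (m z))             ≈⟨ σ-fromCoordinates _ _ ⟩
      η₀.fun 0V ∙ σ (m z)      ≈⟨ ∙-congʳ η₀-0 ⟩
      ε ∙ σ (m z)              ≈⟨ identityˡ _ ⟩
      σ (m z)                  ∎)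
      where
      β-0 : β.fun 0V ≈V 0V
      β-0 = 𝔸G.identityˡ-unique _ _ (proj₁ β0+β0≈β0) , 𝔹G.identityˡ-unique _ _ (proj₂ β0+β0≈β0)
        where β0+β0≈β0 = ≈V-trans (≈V-sym (β.f-+ 0V 0V)) (β.f-cong (+V-identityʳ 0V))
      η₀-0 : η₀.fun 0V ≈ ε
      η₀-0 = identityˡ-unique _ _ (trans (sym (η₀.hom 0V 0V)) (η₀.cong (+V-identityʳ 0V)))

    aut : Aut⁰
    aut = record
      { to = to ; from = from ; to-cong = to-cong ; from-cong = from-cong
      ; to-from = to-from ; from-to = from-to ; hom = to-hom ; fixZ = to-fixZ
      ; bar-+ = β.f-+ ; bar-· = β.f-· }

    Θ-aut : Θ ηHom barSp aut ≈SD (η₀ , α)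
    Θ-aut = (λ u → trans (Aut⁰-Properties.η≈σ aut u)
                     (trans (σ-fromCoordinates _ _) (trans (∙-congˡ (σ-𝒟 u)) (identityʳ _))))
          , (λ u → ≈V-refl)

  Θ-isAntiIso : IsAntiIso (Θ ηHom barSp)
  Θ-isAntiIso = record
    { cong       = λ {φ} {ψ} → Θ-cong {φ} {ψ}
    ; injective  = λ {φ} {ψ} → Θ-injective {φ} {ψ}
    ; surjective = λ (η₀ , α) → Θ-Preimage.aut η₀ α , Θ-Preimage.Θ-aut η₀ α
    ; anti-hom   = Θ-anti-hom
    }

theorem6p2 : ∀ {ρ ℓρ α ℓα β ℓβ γ ℓγ}
    (R : CommutativeRing ρ ℓρ) (A : Module R α ℓα) (B : Module R β ℓβ)
    (C : AbelianGroup γ ℓγ) (r : ℕ) →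
    Finite (Module.≈ᴹ-setoid A) → Finite (Module.≈ᴹ-setoid B) →
    IsCyclic C → HasCardinality r (AbelianGroup.setoid C) → Odd r →
    (lam : Module.Carrierᴹ A → Module.Carrierᴹ B → AbelianGroup.Carrier C) →
    (bil : IsBilinear R A B C lam) → IsRBalanced R A B C lam → IsNonDegenerate R A B C lam →
    ¬ (∀ x → Module._≈ᴹ_ A x (Module.0ᴹ A)) →
    (half : AbelianGroup.Carrier C → AbelianGroup.Carrier C) →
    (∀ z → AbelianGroup._≈_ C (AbelianGroup._∙_ C (half z) (half z)) z) →
    let open Heisenberg R A B C lam bil half in
    (∀ φ u → Aut⁰.to φ (𝒟 u) ≈H (𝒟 (bar φ u) *H m (η φ u))) ×
    Σ[ ηHom ∈ (∀ φ → IsHom (η φ)) ]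
    Σ[ barSp ∈ (∀ φ → IsSp (bar φ) (barInv φ)) ]
    IsAntiIso (Θ ηHom barSp)
theorem6p2 R A B C _ _ _ cyclic _ _ lam bil _ _ _ half half-double =
  Aut⁰-Properties.𝒟-image , ηHom , barSp , Θ-isAntiIso
  where open HeisenbergAutomorphisms R A B C cyclic lam bil half half-double
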